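{- Let $\mathcal N$ be one of the algebras $\langle\mathbb N;\mathrm{Suc}\rangle$, $\langle\mathbb N;+\rangle$, $\langle\mathbb N;+,\times\rangle$. For any $f\colon\mathbb N\to\mathbb N$ the following are equivalent: (i) $f$ is $\mathcal N$-stable-preorder preserving; (ii) $f^{ -1}(L)\in\mathrm{Latt}^{\infty}_{\mathcal N}(L)$ for every $\mathcal N$-recognizable $L\subseteq\mathbb N$.
   Context: A relation on $\mathbb N$ is $\mathcal N$-stable if compatible with each operation of $\mathcal N$; stable preorders are stable reflexive transitive relations; congruences are stable equivalences; $f$ is stable-preorder preserving if $x\preceq y\Rightarrow f(x)\preceq f(y)$ for every stable preorder $\preceq$. $L$ is $\mathcal N$-recognizable if it is a union of classes of some congruence with finitely many classes. The 1-freezifications of an operation $\xi$ of arity $n\ge2$ are the maps $x\mapsto\xi(c_1,\dots,c_{i-1},x,c_{i+1},\dots,c_n)$ with $c_j\in\mathbb N$; a unary operation is its own 1-freezification; $\mathrm{Freez}^*(\mathcal N)$ is the set of finite (possibly empty) compositions of 1-freezifications. $\mathrm{Latt}^{\infty}_{\mathcal N}(L)$ is the smallest family of subsets of $\mathbb N$ containing $L$, closed under arbitrary (including empty) unions and intersections and under $X\mapsto\gamma^{ -1}(X)$ for all $\gamma\in\mathrm{Freez}^*(\mathcal N)$. -}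

module Defs where

open import Level using (0ℓ)
open import Data.Nat using (ℕ; suc; _+_; _*_)
open import Data.Fin using (Fin)
open import Data.Vec using (Vec; []; _∷_; _[_]≔_)
open import Data.Vec.Relation.Binary.Pointwise.Inductive using (Pointwise)
open import Data.List using (List; []; _∷_)
open import Data.Product using (Σ; ∃; _×_)
open import Function using (_∘_; id)
open import Function.Bundles using (_⇔_)
open import Relation.Binary.PropositionalEquality using (_≡_)
open import Relation.Binary.Structures using (IsPreorder; IsEquivalence)

data Algebra : Set where
  SucAlg PlusAlg PlusTimesAlg : Algebra

data Op : Algebra → Set where
  sucOp         : Op SucAlg
  plusOp        : Op PlusAlg
  plusOp′ timesOp : Op PlusTimesAlg

arity : {𝒩 : Algebra} → Op 𝒩 → ℕ
arity sucOp   = 1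
arity plusOp  = 2
arity plusOp′ = 2
arity timesOp = 2

interp : {𝒩 : Algebra} → (o : Op 𝒩) → Vec ℕ (arity o) → ℕ
interp sucOp   (x ∷ [])     = suc x
interp plusOp  (x ∷ y ∷ []) = x + y
interp plusOp′ (x ∷ y ∷ []) = x + y
interp timesOp (x ∷ y ∷ []) = x * y

Subset : Set₁
Subset = ℕ → Set

Rel : Set₁
Rel = ℕ → ℕ → Set

Stable : Algebra → Rel → Set
Stable 𝒩 R = (o : Op 𝒩) (xs ys : Vec ℕ (arity o)) →
             Pointwise R xs ys → R (interp o xs) (interp o ys)

IsStablePreorder : Algebra → Rel → Set
IsStablePreorder 𝒩 R = IsPreorder _≡_ R × Stable 𝒩 R

IsCongruence : Algebra → Rel → Set
IsCongruence 𝒩 R = IsEquivalence R × Stable 𝒩 R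

StablePreorderPreserving : Algebra → (ℕ → ℕ) → Set₁
StablePreorderPreserving 𝒩 f =
  (R : Rel) → IsStablePreorder 𝒩 R → ∀ x y → R x y → R (f x) (f y)

FinitelyManyClasses : Rel → Set
FinitelyManyClasses R = Σ ℕ λ k → Σ (Fin k → ℕ) λ r → ∀ x → ∃ λ i → R x (r i)

UnionOfClasses : Rel → Subset → Set
UnionOfClasses R L = ∀ x y → R x y → L x → L y

Recognizable : Algebra → Subset → Set₁
Recognizable 𝒩 L = Σ Rel λ R →
  IsCongruence 𝒩 R × FinitelyManyClasses R × UnionOfClasses R L

-- 1-freezifications: x ↦ ξ(c₁,…,c_{i-1},x,c_{i+1},…,c_n)
-- (for a unary ξ this is ξ itself, the constant vector being irrelevant)
record Freez1 (𝒩 : Algebra) : Set where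
  constructor freez
  field
    op     : Op 𝒩
    pos    : Fin (arity op)
    consts : Vec ℕ (arity op)

apply1 : {𝒩 : Algebra} → Freez1 𝒩 → ℕ → ℕ
apply1 (freez o i cs) x = interp o (cs [ i ]≔ x)

FreezStar : Algebra → Set
FreezStar 𝒩 = List (Freez1 𝒩)

applyStar : {𝒩 : Algebra} → FreezStar 𝒩 → ℕ → ℕ
applyStar []       = id
applyStar (g ∷ gs) = apply1 g ∘ applyStar gs

-- Latt^∞_𝒩(L) X : X belongs to the smallest family containing L, closed under
-- arbitrary unions/intersections and preimages by Freez*(𝒩); membership is
-- up to extensional equality of subsets.
data Latt (𝒩 : Algebra) (L : Subset) : Subset → Set₁ where
  base  : Latt 𝒩 L L
  union : (I : Set) (X : I → Subset) → (∀ i → Latt 𝒩 L (X i)) →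
          Latt 𝒩 L (λ n → Σ I λ i → X i n)
  inter : (I : Set) (X : I → Subset) → (∀ i → Latt 𝒩 L (X i)) →
          Latt 𝒩 L (λ n → (i : I) → X i n)
  pre   : (γ : FreezStar 𝒩) {X : Subset} → Latt 𝒩 L X →
          Latt 𝒩 L (λ n → X (applyStar γ n))
  ext   : {X Y : Subset} → Latt 𝒩 L X → (∀ n → X n ⇔ Y n) → Latt 𝒩 L Y

{-# OPTIONS --safe #-}
-- (i) ⇒ (ii): the syntactic preorder of L, where a ≲ b iff γ a ∈ L implies γ b ∈ L for every
-- γ ∈ Freez*(𝒩), is a stable preorder, so f preserves it. Hence f⁻¹(L) is upward closed, so it is the
-- union of the principal up-sets of its elements, each an intersection of sets γ⁻¹(L).
-- (ii) ⇒ (i): every member of Latt(L) is upward closed for any preorder that is compatible with the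
-- freezifications and for which L is upward closed. Given a stable preorder ≼ with x ≼ x + D, the
-- preorder "a = b, or x ≤ a and b = a + jD" lies inside ≼, is compatible with the freezifications, and
-- has eventually periodic, hence recognizable, principal up-sets; applying (ii) to the up-set of f x
-- gives f x ≼ f (x + D). The case x + D ≼ x is dual, using the (finite) principal down-sets.
module Submission where

open import Defs
open import Data.Nat using (ℕ)
open import Function.Bundles using (_⇔_)

open import Data.Nat
  using (zero; suc; _+_; _*_; _∸_; _≤_; _<_; NonZero; _%_; _/_; compare; less; equal; greater)
open import Data.Nat.Properties
open import Data.Nat.DivMod
  using (m≡m%n+[m/n]*n; [m+kn]%n≡m%n; %-distribˡ-+; %-distribˡ-*; m%n<n; /-monoˡ-≤)
open import Data.Fin using (Fin; toℕ; fromℕ<) renaming (zero to fzero; suc to fsuc)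
open import Data.Fin.Properties using (toℕ-fromℕ<)
open import Data.Vec using ([]; _∷_)
open import Data.Vec.Relation.Binary.Pointwise.Inductive using ([]; _∷_)
open import Data.List using ([]; _∷_; _∷ʳ_)
open import Data.Product using (Σ; ∃; _×_; _,_)
open import Data.Sum using (_⊎_; inj₁; inj₂)
open import Data.Empty using (⊥-elim)
open import Function using (flip)
open import Function.Bundles using (mk⇔; module Equivalence)
open import Relation.Binary.Core using (_⇒_; _Preserves_⟶_)
open import Relation.Binary.Structures using (IsPreorder; IsEquivalence)
open import Relation.Binary.PropositionalEquality
  using (_≡_; refl; sym; trans; cong; cong₂; subst; subst₂; isEquivalence; module ≡-Reasoning)
import Relation.Binary.Construct.Flip.EqAndOrd as Flip

FreezCompatible : Algebra → Rel → Set
FreezCompatible 𝒩 T = (g : Freez1 𝒩) → apply1 g Preserves T ⟶ T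

UpwardClosed : Rel → Subset → Set
UpwardClosed T X = ∀ {a b} → T a b → X a → X b

PreimagesInLatt : Algebra → (ℕ → ℕ) → Set₁
PreimagesInLatt 𝒩 f = (L : Subset) → Recognizable 𝒩 L → Latt 𝒩 L (λ n → L (f n))

module _ {𝒩 : Algebra} {T : Rel} where

  applyStar-preserves : FreezCompatible 𝒩 T → (γ : FreezStar 𝒩) → applyStar γ Preserves T ⟶ T
  applyStar-preserves compat []      r = r
  applyStar-preserves compat (g ∷ γ) r = compat g (applyStar-preserves compat γ r)

  freezCompatible-flip : FreezCompatible 𝒩 T → FreezCompatible 𝒩 (flip T)
  freezCompatible-flip compat g = compat g

  Latt-upwardClosed : FreezCompatible 𝒩 T → {L X : Subset} →
                      UpwardClosed T L → Latt 𝒩 L X → UpwardClosed T X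
  Latt-upwardClosed compat upL base           r x       = upL r x
  Latt-upwardClosed compat upL (union I X l)  r (i , x) = i , Latt-upwardClosed compat upL (l i) r x
  Latt-upwardClosed compat upL (inter I X l)  r x       = λ i → Latt-upwardClosed compat upL (l i) r (x i)
  Latt-upwardClosed compat upL (pre γ l)      r x       =
    Latt-upwardClosed compat upL l (applyStar-preserves compat γ r) x
  Latt-upwardClosed compat upL (ext l X⇔Y) {a} {b} r y =
    Equivalence.to (X⇔Y b) (Latt-upwardClosed compat upL l r (Equivalence.from (X⇔Y a) y))

  leftCompatible⇒freezCompatible : (∀ e {a b} → T a b → T (e + a) (e + b)) →
                                   (∀ e {a b} → T a b → T (e * a) (e * b)) →
                                   FreezCompatible 𝒩 T
  leftCompatible⇒freezCompatible +ˡ *ˡ (freez sucOp   fzero        (_ ∷ []))     = +ˡ 1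
  leftCompatible⇒freezCompatible +ˡ *ˡ (freez plusOp  (fsuc fzero) (c ∷ _ ∷ [])) = +ˡ c
  leftCompatible⇒freezCompatible +ˡ *ˡ (freez plusOp′ (fsuc fzero) (c ∷ _ ∷ [])) = +ˡ c
  leftCompatible⇒freezCompatible +ˡ *ˡ (freez timesOp (fsuc fzero) (c ∷ _ ∷ [])) = *ˡ c
  leftCompatible⇒freezCompatible +ˡ *ˡ (freez plusOp  fzero (_ ∷ e ∷ [])) {a} {b} r =
    subst₂ T (+-comm e a) (+-comm e b) (+ˡ e r)
  leftCompatible⇒freezCompatible +ˡ *ˡ (freez plusOp′ fzero (_ ∷ e ∷ [])) {a} {b} r =
    subst₂ T (+-comm e a) (+-comm e b) (+ˡ e r)
  leftCompatible⇒freezCompatible +ˡ *ˡ (freez timesOp fzero (_ ∷ e ∷ [])) {a} {b} r =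
    subst₂ T (*-comm e a) (*-comm e b) (*ˡ e r)

  freezCompatible⇒stable : IsPreorder _≡_ T → FreezCompatible 𝒩 T → Stable 𝒩 T
  freezCompatible⇒stable isPre compat = stable
    where
    open IsPreorder isPre renaming (trans to ≲-trans)
    stable : Stable 𝒩 T
    stable sucOp   (_ ∷ [])     (_ ∷ [])      (r ∷ [])     = compat (freez sucOp fzero (0 ∷ [])) r
    stable plusOp  (_ ∷ y ∷ []) (x′ ∷ _ ∷ []) (r ∷ s ∷ []) =
      ≲-trans (compat (freez plusOp fzero (0 ∷ y ∷ [])) r)
              (compat (freez plusOp (fsuc fzero) (x′ ∷ 0 ∷ [])) s)
    stable plusOp′ (_ ∷ y ∷ []) (x′ ∷ _ ∷ []) (r ∷ s ∷ []) =
      ≲-trans (compat (freez plusOp′ fzero (0 ∷ y ∷ [])) r)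
              (compat (freez plusOp′ (fsuc fzero) (x′ ∷ 0 ∷ [])) s)
    stable timesOp (_ ∷ y ∷ []) (x′ ∷ _ ∷ []) (r ∷ s ∷ []) =
      ≲-trans (compat (freez timesOp fzero (0 ∷ y ∷ [])) r)
              (compat (freez timesOp (fsuc fzero) (x′ ∷ 0 ∷ [])) s)

stable⇒suc-preserving : (𝒩 : Algebra) {T : Rel} → IsPreorder _≡_ T → Stable 𝒩 T → suc Preserves T ⟶ T
stable⇒suc-preserving SucAlg       isPre stable {a} {b} r = stable sucOp (a ∷ []) (b ∷ []) (r ∷ [])
stable⇒suc-preserving PlusAlg      isPre stable {a} {b} r =
  stable plusOp (1 ∷ a ∷ []) (1 ∷ b ∷ []) (IsPreorder.refl isPre ∷ r ∷ [])
stable⇒suc-preserving PlusTimesAlg isPre stable {a} {b} r =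
  stable plusOp′ (1 ∷ a ∷ []) (1 ∷ b ∷ []) (IsPreorder.refl isPre ∷ r ∷ [])

Syntactic : Algebra → Subset → Rel
Syntactic 𝒩 L a b = (γ : FreezStar 𝒩) → L (applyStar γ a) → L (applyStar γ b)

applyStar-∷ʳ : {𝒩 : Algebra} (γ : FreezStar 𝒩) (g : Freez1 𝒩) (n : ℕ) →
               applyStar (γ ∷ʳ g) n ≡ applyStar γ (apply1 g n)
applyStar-∷ʳ []      g n = refl
applyStar-∷ʳ (h ∷ γ) g n = cong (apply1 h) (applyStar-∷ʳ γ g n)

module _ {𝒩 : Algebra} (L : Subset) where

  Syntactic-isPreorder : IsPreorder _≡_ (Syntactic 𝒩 L)
  Syntactic-isPreorder = record
    { isEquivalence = isEquivalence
    ; reflexive     = λ { refl γ La → La }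
    ; trans         = λ s t γ La → t γ (s γ La)
    }

  Syntactic-freezCompatible : FreezCompatible 𝒩 (Syntactic 𝒩 L)
  Syntactic-freezCompatible g {a} {b} s γ Lγga =
    subst L (applyStar-∷ʳ γ g b) (s (γ ∷ʳ g) (subst L (sym (applyStar-∷ʳ γ g a)) Lγga))

  Syntactic-isStablePreorder : IsStablePreorder 𝒩 (Syntactic 𝒩 L)
  Syntactic-isStablePreorder =
    Syntactic-isPreorder , freezCompatible⇒stable Syntactic-isPreorder Syntactic-freezCompatible

  Syntactic-upwardClosed : UpwardClosed (Syntactic 𝒩 L) L
  Syntactic-upwardClosed s = s []

  Syntactic-upset∈Latt : (n : ℕ) → Latt 𝒩 L (Syntactic 𝒩 L n)
  Syntactic-upset∈Latt n =
    ext (inter (Σ (FreezStar 𝒩) λ γ → L (applyStar γ n)) (λ (γ , _) m → L (applyStar γ m))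
               (λ (γ , _) → pre γ base))
        (λ m → mk⇔ (λ s γ Lγn → s (γ , Lγn)) (λ s (γ , Lγn) → s γ Lγn))

  Syntactic-upwardClosed∈Latt : {X : Subset} → UpwardClosed (Syntactic 𝒩 L) X → Latt 𝒩 L X
  Syntactic-upwardClosed∈Latt {X} upX =
    ext (union (Σ ℕ X) (λ (n , _) → Syntactic 𝒩 L n) (λ (n , _) → Syntactic-upset∈Latt n))
        (λ m → mk⇔ (λ ((n , Xn) , n≲m) → upX n≲m Xn) (λ Xm → (m , Xm) , λ γ Lγm → Lγm))

stablePreorderPreserving⇒preimage∈Latt : {𝒩 : Algebra} {f : ℕ → ℕ} → StablePreorderPreserving 𝒩 f →
                                         (L : Subset) → Latt 𝒩 L (λ n → L (f n))
stablePreorderPreserving⇒preimage∈Latt {𝒩} {f} preserving L =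
  Syntactic-upwardClosed∈Latt L λ {a} {b} a≲b →
    Syntactic-upwardClosed L (preserving (Syntactic 𝒩 L) (Syntactic-isStablePreorder L) a b a≲b)

m≤n⇒n%d≡m%d⇒∃[j]n≡m+j*d : ∀ {m n d} .{{_ : NonZero d}} →
                           m ≤ n → n % d ≡ m % d → ∃ λ j → n ≡ m + j * d
m≤n⇒n%d≡m%d⇒∃[j]n≡m+j*d {m} {n} {d} m≤n n%d≡m%d = j , (begin
  n                             ≡⟨ m≡m%n+[m/n]*n n d ⟩
  n % d + n / d * d             ≡⟨ cong₂ (λ r q → r + q * d) n%d≡m%d (sym m/d+j≡n/d) ⟩
  m % d + (m / d + j) * d       ≡⟨ cong (m % d +_) (*-distribʳ-+ d (m / d) j) ⟩
  m % d + (m / d * d + j * d)   ≡⟨ +-assoc (m % d) _ _ ⟨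
  m % d + m / d * d + j * d     ≡⟨ cong (_+ j * d) (m≡m%n+[m/n]*n m d) ⟨
  m + j * d                     ∎)
  where
  open ≡-Reasoning
  j = n / d ∸ m / d
  m/d+j≡n/d : m / d + j ≡ n / d
  m/d+j≡n/d = m+[n∸m]≡n (/-monoˡ-≤ d m≤n)

module Threshold (M D : ℕ) .{{_ : NonZero D}} where

  infix 4 _∼_
  _∼_ : Rel
  a ∼ b = a ≡ b ⊎ (M ≤ a × M ≤ b × a % D ≡ b % D)

  ∼-refl : ∀ {a} → a ∼ a
  ∼-refl = inj₁ refl

  ∼-sym : ∀ {a b} → a ∼ b → b ∼ a
  ∼-sym (inj₁ refl)              = ∼-refl
  ∼-sym (inj₂ (M≤a , M≤b , a≡b)) = inj₂ (M≤b , M≤a , sym a≡b)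

  ∼-trans : ∀ {a b c} → a ∼ b → b ∼ c → a ∼ c
  ∼-trans (inj₁ refl)            b∼c                    = b∼c
  ∼-trans a∼b                    (inj₁ refl)            = a∼b
  ∼-trans (inj₂ (M≤a , _ , a≡b)) (inj₂ (_ , M≤c , b≡c)) = inj₂ (M≤a , M≤c , trans a≡b b≡c)

  ∼-isEquivalence : IsEquivalence _∼_
  ∼-isEquivalence = record { refl = ∼-refl ; sym = ∼-sym ; trans = ∼-trans }

  ∼-isPreorder : IsPreorder _≡_ _∼_
  ∼-isPreorder = record
    { isEquivalence = isEquivalence
    ; reflexive     = λ { refl → ∼-refl }
    ; trans         = ∼-trans
    }

  %-distrib⇒congˡ : (_∙_ : ℕ → ℕ → ℕ) → (∀ m n → (m ∙ n) % D ≡ ((m % D) ∙ (n % D)) % D) →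
                    ∀ e {a b} → a % D ≡ b % D → (e ∙ a) % D ≡ (e ∙ b) % D
  %-distrib⇒congˡ _∙_ distrib e {a} {b} a≡b =
    trans (distrib e a) (trans (cong (λ r → ((e % D) ∙ r) % D) a≡b) (sym (distrib e b)))

  ∼-+ˡ : ∀ e {a b} → a ∼ b → e + a ∼ e + b
  ∼-+ˡ e         (inj₁ refl)              = ∼-refl
  ∼-+ˡ e {a} {b} (inj₂ (M≤a , M≤b , a≡b)) =
    inj₂ (≤-trans M≤a (m≤n+m a e) , ≤-trans M≤b (m≤n+m b e) ,
          %-distrib⇒congˡ _+_ (λ m n → %-distribˡ-+ m n D) e a≡b)

  ∼-*ˡ : ∀ e {a b} → a ∼ b → e * a ∼ e * b
  ∼-*ˡ e                 (inj₁ refl)              = ∼-refl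
  ∼-*ˡ zero              (inj₂ _)                 = ∼-refl
  ∼-*ˡ e@(suc _) {a} {b} (inj₂ (M≤a , M≤b , a≡b)) =
    inj₂ (≤-trans M≤a (m≤n*m a e) , ≤-trans M≤b (m≤n*m b e) ,
          %-distrib⇒congˡ _*_ (λ m n → %-distribˡ-* m n D) e a≡b)

  ∼-isCongruence : {𝒩 : Algebra} → IsCongruence 𝒩 _∼_
  ∼-isCongruence =
    ∼-isEquivalence , freezCompatible⇒stable ∼-isPreorder (leftCompatible⇒freezCompatible ∼-+ˡ ∼-*ˡ)

  above-threshold-representative : ∀ {w} → M ≤ w → w % D ≡ (M + (w ∸ M) % D) % D
  above-threshold-representative {w} M≤w = begin
    w % D                           ≡⟨ cong (_% D) w≡r+q*D ⟩
    (M + (w ∸ M) % D + q * D) % D   ≡⟨ [m+kn]%n≡m%n (M + (w ∸ M) % D) q D ⟩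
    (M + (w ∸ M) % D) % D           ∎
    where
    open ≡-Reasoning
    q = (w ∸ M) / D
    w≡r+q*D : w ≡ M + (w ∸ M) % D + q * D
    w≡r+q*D = begin
      w                           ≡⟨ m+[n∸m]≡n M≤w ⟨
      M + (w ∸ M)                 ≡⟨ cong (M +_) (m≡m%n+[m/n]*n (w ∸ M) D) ⟩
      M + ((w ∸ M) % D + q * D)   ≡⟨ +-assoc M _ _ ⟨
      M + (w ∸ M) % D + q * D     ∎

  ∼-finitelyManyClasses : FinitelyManyClasses _∼_
  ∼-finitelyManyClasses = M + D , toℕ , covered
    where
    representedBy : ∀ {w r} → r < M + D → w ∼ r → ∃ λ (i : Fin (M + D)) → w ∼ toℕ i
    representedBy {w} r<M+D w∼r = fromℕ< r<M+D , subst (w ∼_) (sym (toℕ-fromℕ< r<M+D)) w∼r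
    covered : ∀ w → ∃ λ (i : Fin (M + D)) → w ∼ toℕ i
    covered w with <-≤-connex w M
    ... | inj₁ w<M = representedBy (<-≤-trans w<M (m≤m+n M D)) ∼-refl
    ... | inj₂ M≤w = representedBy (+-monoʳ-< M (m%n<n (w ∸ M) D))
                       (inj₂ (M≤w , m≤m+n M _ , above-threshold-representative M≤w))

  eventuallyPeriodic⇒recognizable : {𝒩 : Algebra} {L : Subset} →
    (∀ {a b} → M ≤ a → M ≤ b → a % D ≡ b % D → L a → L b) → Recognizable 𝒩 L
  eventuallyPeriodic⇒recognizable {L = L} periodic =
    _∼_ , ∼-isCongruence , ∼-finitelyManyClasses , saturated
    where
    saturated : UnionOfClasses _∼_ L
    saturated a b (inj₁ refl)              La = La
    saturated a b (inj₂ (M≤a , M≤b , a≡b)) La = periodic M≤a M≤b a≡b La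

-- The least suc-compatible preorder relating B to B + D.
Steps : ℕ → ℕ → Rel
Steps B D a b = a ≡ b ⊎ (B ≤ a × ∃ λ j → b ≡ a + j * D)

module _ {B D : ℕ} where

  Steps-base : Steps B D B (B + D)
  Steps-base = inj₂ (≤-refl , 1 , cong (B +_) (sym (*-identityˡ D)))

  Steps-≤ : ∀ {a b} → Steps B D a b → a ≤ b
  Steps-≤     (inj₁ refl)           = ≤-refl
  Steps-≤ {a} (inj₂ (_ , j , refl)) = m≤m+n a (j * D)

  Steps-trans : ∀ {a b c} → Steps B D a b → Steps B D b c → Steps B D a c
  Steps-trans (inj₁ refl) b→c         = b→c
  Steps-trans a→b         (inj₁ refl) = a→b
  Steps-trans {a} (inj₂ (B≤a , i , refl)) (inj₂ (_ , j , refl)) =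
    inj₂ (B≤a , i + j , trans (+-assoc a (i * D) (j * D)) (cong (a +_) (sym (*-distribʳ-+ D i j))))

  Steps-isPreorder : IsPreorder _≡_ (Steps B D)
  Steps-isPreorder = record
    { isEquivalence = isEquivalence
    ; reflexive     = λ { refl → inj₁ refl }
    ; trans         = Steps-trans
    }

  Steps-+ˡ : ∀ e {a b} → Steps B D a b → Steps B D (e + a) (e + b)
  Steps-+ˡ e     (inj₁ refl)             = inj₁ refl
  Steps-+ˡ e {a} (inj₂ (B≤a , j , refl)) =
    inj₂ (≤-trans B≤a (m≤n+m a e) , j , sym (+-assoc e a (j * D)))

  Steps-*ˡ : ∀ e {a b} → Steps B D a b → Steps B D (e * a) (e * b)
  Steps-*ˡ e             (inj₁ refl) = inj₁ refl
  Steps-*ˡ zero          (inj₂ _)    = inj₁ refl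
  Steps-*ˡ e@(suc _) {a} (inj₂ (B≤a , j , refl)) =
    inj₂ (≤-trans B≤a (m≤n*m a e) , e * j ,
          trans (*-distribˡ-+ e a (j * D)) (cong (e * a +_) (sym (*-assoc e j D))))

  Steps-freezCompatible : {𝒩 : Algebra} → FreezCompatible 𝒩 (Steps B D)
  Steps-freezCompatible = leftCompatible⇒freezCompatible Steps-+ˡ Steps-*ˡ

  Steps-upset-recognizable : {𝒩 : Algebra} .{{_ : NonZero D}} (z : ℕ) →
                             Recognizable 𝒩 (Steps B D z)
  Steps-upset-recognizable z = Threshold.eventuallyPeriodic⇒recognizable (suc z) D periodic
    where
    periodic : ∀ {a b} → z < a → z < b → a % D ≡ b % D → Steps B D z a → Steps B D z b
    periodic z<a _   _   (inj₁ refl)             = ⊥-elim (n≮n z z<a)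
    periodic _   z<b a≡b (inj₂ (B≤z , j , refl)) =
      inj₂ (B≤z , m≤n⇒n%d≡m%d⇒∃[j]n≡m+j*d (<⇒≤ z<b) (trans (sym a≡b) ([m+kn]%n≡m%n z j D)))

  Steps-downset-recognizable : {𝒩 : Algebra} (z : ℕ) → Recognizable 𝒩 (flip (Steps B D) z)
  Steps-downset-recognizable z = Threshold.eventuallyPeriodic⇒recognizable (suc z) 1
    λ z<a _ _ a→z → ⊥-elim (<⇒≱ z<a (Steps-≤ a→z))

module _ {R : Rel} (isPreorder : IsPreorder _≡_ R) (suc-preserving : suc Preserves R ⟶ R)
         {B D : ℕ} (B≲B+D : R B (B + D)) where
  open IsPreorder isPreorder using (reflexive) renaming (trans to ≲-trans)

  private
    shifted-step : ∀ c → R (c + B) (c + B + D)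
    shifted-step zero    = B≲B+D
    shifted-step (suc c) = suc-preserving (shifted-step c)

    step : ∀ {a} → B ≤ a → R a (a + D)
    step {a} B≤a = subst (λ x → R x (x + D)) (m∸n+n≡m B≤a) (shifted-step (a ∸ B))

    steps : ∀ {a} → B ≤ a → ∀ j → R a (a + j * D)
    steps {a} _   zero    = reflexive (sym (+-identityʳ a))
    steps {a} B≤a (suc j) = ≲-trans (step B≤a)
      (subst (R (a + D)) (+-assoc a D (j * D)) (steps (≤-trans B≤a (m≤m+n a D)) j))

  Steps⇒ : Steps B D ⇒ R
  Steps⇒ (inj₁ refl)             = reflexive refl
  Steps⇒ (inj₂ (B≤a , j , refl)) = steps B≤a j

module _ {𝒩 : Algebra} {f : ℕ → ℕ} (preimages : PreimagesInLatt 𝒩 f) where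

  preimagesInLatt⇒preserves : {T : Rel} → IsPreorder _≡_ T → FreezCompatible 𝒩 T →
                              (∀ z → Recognizable 𝒩 (T z)) → f Preserves T ⟶ T
  preimagesInLatt⇒preserves {T} isPreorder compat recognizable {x} x≲y =
    Latt-upwardClosed compat (λ a≲b z≲a → ≲-trans z≲a a≲b)
                      (preimages (T (f x)) (recognizable (f x))) x≲y ≲-refl
    where open IsPreorder isPreorder renaming (refl to ≲-refl; trans to ≲-trans)

  module _ {R : Rel} (isPreorder : IsPreorder _≡_ R) (stable : Stable 𝒩 R) where
    private
      suc-preserving : suc Preserves R ⟶ R
      suc-preserving = stable⇒suc-preserving 𝒩 isPreorder stable

    preserves-ascending : ∀ {x} D .{{_ : NonZero D}} → R x (x + D) → R (f x) (f (x + D))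
    preserves-ascending D x≲x+D = Steps⇒ isPreorder suc-preserving x≲x+D
      (preimagesInLatt⇒preserves Steps-isPreorder Steps-freezCompatible Steps-upset-recognizable Steps-base)

    preserves-descending : ∀ {y} D → R (y + D) y → R (f (y + D)) (f y)
    preserves-descending D y+D≲y = Steps⇒ (Flip.isPreorder isPreorder) suc-preserving y+D≲y
      (preimagesInLatt⇒preserves (Flip.isPreorder Steps-isPreorder)
                                 (freezCompatible-flip Steps-freezCompatible)
                                 Steps-downset-recognizable Steps-base)

  preimagesInLatt⇒stablePreorderPreserving : StablePreorderPreserving 𝒩 f
  preimagesInLatt⇒stablePreorderPreserving R (isPreorder , stable) x y x≲y with compare x y
  ... | less _ k    = subst (λ t → R (f x) (f t)) (+-suc x k)
    (preserves-ascending isPreorder stable (suc k) (subst (R x) (sym (+-suc x k)) x≲y))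
  ... | equal _     = IsPreorder.refl isPreorder
  ... | greater _ k = subst (λ t → R (f t) (f y)) (+-suc y k)
    (preserves-descending isPreorder stable (suc k) (subst (λ t → R t y) (sym (+-suc y k)) x≲y))

theorem5p14 : (𝒩 : Algebra) (f : ℕ → ℕ) →
    StablePreorderPreserving 𝒩 f ⇔
    ((L : Subset) → Recognizable 𝒩 L → Latt 𝒩 L (λ n → L (f n)))
theorem5p14 𝒩 f = mk⇔ (λ preserving L _ → stablePreorderPreserving⇒preimage∈Latt preserving L)
                      preimagesInLatt⇒stablePreorderPreserving
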